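{- The sequence $(c_k)_{k\geq 2}$ defined by $c_2=2$ and $c_k=c_{k-1}+2k\,c_{\lceil k/2\rceil}+20k^2$ for $k\geq 3$ satisfies $c_k=\mathcal{O}(k^{\log_2 k})$. -}

module Defs where

open import Data.Nat using (ℕ; zero; suc; _+_; _*_; _^_; _≤_; _<_; ⌈_/2⌉)
open import Data.Nat.Properties using (n<1+n; ⌈n/2⌉<n)
open import Data.Nat.Induction using (<-rec)

-- One step of the recursion for c, given access to all smaller values.
-- c_0, c_1 are irrelevant (the sequence starts at k = 2); set to 0.
-- c_2 = 2,  c_k = c_{k-1} + 2k c_{⌈k/2⌉} + 20 k²  for k ≥ 3.
cStep : (k : ℕ) → ({j : ℕ} → j < k → ℕ) → ℕ
cStep zero                rec = 0
cStep (suc zero)          rec = 0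
cStep (suc (suc zero))    rec = 2
cStep k@(suc (suc (suc m))) rec =
  rec {suc (suc m)} (n<1+n (suc (suc m)))
  + 2 * k * rec {⌈ k /2⌉} (⌈n/2⌉<n (suc m))
  + 20 * (k * k)

c : ℕ → ℕ
c = <-rec (λ _ → ℕ) cStep

-- LeCPowLog a C k  means  a ≤ C · k^(log₂ k)  (real exponent), stated
-- without reals: for every rational p/q (q ≥ 1) with p/q ≥ log₂ k, i.e.
-- k^q ≤ 2^p, we have a ≤ C · k^(p/q), i.e. a^q ≤ C^q · k^p.  For k ≥ 2 this
-- is equivalent to a ≤ C · k^(log₂ k), since k^(log₂ k) is the infimum of
-- k^(p/q) over such rationals (x ↦ k^x is continuous and increasing).
LeCPowLog : ℕ → ℕ → ℕ → Set
LeCPowLog a C k = (p q : ℕ) → 1 ≤ q → k ^ q ≤ 2 ^ p → a ^ q ≤ C ^ q * k ^ p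

{-# OPTIONS --safe #-}
module Submission where

open import Defs
open import Data.Nat
open import Data.Nat.Properties
open import Data.Nat.Induction using (<-wellFounded)
open import Data.Nat.Tactic.RingSolver using (solve-∀)
open import Data.Product using (∃; ∃₂; _×_; _,_)
open import Induction.WellFounded using (module FixPoint)
open import Relation.Binary.PropositionalEquality
open import Relation.Nullary using (yes; no; contradiction)

-- For every level L ≥ 2 one shows W_L · c k ≤ (k + t_L) ^ (2L) for 3 ≤ k ≤ 2 ^ L, where
-- t_L = 3 · 2 ^ L - 2 and W_(L+1) = 2(L+1) · 4 ^ (L-1) · W_L, by induction on L and then on k.
-- For k ≥ 5 the term 20 k² is absorbed into 2k · c ⌈k/2⌉, and the level-L bound at ⌈k/2⌉ gives
-- W_(L+1) (c k - c (k-1)) ≤ e x ^ (e-1) with e = 2L + 2 and x = k - 1 + t_(L+1), so Bernoulli's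
-- x ^ e + e x ^ (e-1) ≤ (x+1) ^ e closes the induction on k. The factor e gained at every level
-- makes W_L ≥ 2 ^ ((L+3)²) / C, so for 2 ^ (L-1) ≤ k ≤ 2 ^ L
-- c k ≤ 2 ^ (2L(L+2)) / W_L ≤ C · 2 ^ ((L-1)²) ≤ C · k ^ (L-1) ≤ C · k ^ (log₂ k).

cStep-cong : ∀ k {rec rec′ : {j : ℕ} → j < k → ℕ} →
             (∀ {j} (j<k : j < k) → rec j<k ≡ rec′ j<k) → cStep k rec ≡ cStep k rec′
cStep-cong zero                  _  = refl
cStep-cong (suc zero)            _  = refl
cStep-cong (suc (suc zero))      _  = refl
cStep-cong k@(suc (suc (suc _))) eq =
  cong₂ (λ a b → a + 2 * k * b + 20 * (k * k)) (eq _) (eq _)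

c-recurrence : ∀ m → let k = 3 + m in c k ≡ c (2 + m) + 2 * k * c ⌈ k /2⌉ + 20 * (k * k)
c-recurrence m = FixPoint.unfold-wfRec <-wellFounded (λ _ → ℕ) cStep cStep-cong

20*k*k≤c : ∀ k → 3 ≤ k → 20 * (k * k) ≤ c k
20*k*k≤c 1 (s≤s ())
20*k*k≤c 2 (s≤s (s≤s ()))
20*k*k≤c (suc (suc (suc m))) _ rewrite c-recurrence m = m≤n+m _ _

n≤⌈n/2⌉+⌈n/2⌉ : ∀ n → n ≤ ⌈ n /2⌉ + ⌈ n /2⌉
n≤⌈n/2⌉+⌈n/2⌉ n = subst (_≤ ⌈ n /2⌉ + ⌈ n /2⌉) (⌊n/2⌋+⌈n/2⌉≡n n)
  (+-monoˡ-≤ ⌈ n /2⌉ (⌊n/2⌋≤⌈n/2⌉ n))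

⌈n/2⌉+⌈n/2⌉≤1+n : ∀ n → ⌈ n /2⌉ + ⌈ n /2⌉ ≤ suc n
⌈n/2⌉+⌈n/2⌉≤1+n n = subst (⌈ n /2⌉ + ⌈ n /2⌉ ≤_) (⌊n/2⌋+⌈n/2⌉≡n (suc n))
  (+-monoʳ-≤ ⌈ n /2⌉ (⌈n/2⌉-mono (n≤1+n n)))

c[5+m]≤c[4+m]+4*k*c⌈k/2⌉ : ∀ m → let k = 5 + m in c k ≤ c (4 + m) + 4 * k * c ⌈ k /2⌉
c[5+m]≤c[4+m]+4*k*c⌈k/2⌉ m = begin
    c k
  ≡⟨ c-recurrence (2 + m) ⟩
    c j + 2 * k * c h + 20 * (k * k)
  ≡⟨ cong (c j + 2 * k * c h +_) (20*k*k≡2*k*[10*k] k) ⟩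
    c j + 2 * k * c h + 2 * k * (10 * k)
  ≤⟨ +-monoʳ-≤ (c j + 2 * k * c h) (*-monoʳ-≤ (2 * k) 10*k≤c⌈k/2⌉) ⟩
    c j + 2 * k * c h + 2 * k * c h
  ≡⟨ collect (c j) k (c h) ⟩
    c j + 4 * k * c h ∎
  where
  open ≤-Reasoning
  k = 5 + m
  j = 4 + m
  h = ⌈ k /2⌉
  3≤h : 3 ≤ h
  3≤h = ⌈n/2⌉-mono {5} {k} (m≤m+n 5 m)
  10*k≤c⌈k/2⌉ : 10 * k ≤ c h
  10*k≤c⌈k/2⌉ = begin
      10 * k
    ≤⟨ *-monoʳ-≤ 10 (n≤⌈n/2⌉+⌈n/2⌉ k) ⟩
      10 * (h + h)
    ≡⟨ 10*[h+h]≡20*h h ⟩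
      20 * h
    ≤⟨ *-monoʳ-≤ 20 (m≤m*n h h {{>-nonZero (≤-trans (s≤s z≤n) 3≤h)}}) ⟩
      20 * (h * h)
    ≤⟨ 20*k*k≤c h 3≤h ⟩
      c h ∎
    where
    10*[h+h]≡20*h : ∀ h → 10 * (h + h) ≡ 20 * h
    10*[h+h]≡20*h = solve-∀
  20*k*k≡2*k*[10*k] : ∀ k → 20 * (k * k) ≡ 2 * k * (10 * k)
  20*k*k≡2*k*[10*k] = solve-∀
  collect : ∀ a k b → a + 2 * k * b + 2 * k * b ≡ a + 4 * k * b
  collect = solve-∀

x^[1+n]+[1+n]*x^n≤[1+x]^[1+n] : ∀ x n → x ^ suc n + suc n * x ^ n ≤ suc x ^ suc n
x^[1+n]+[1+n]*x^n≤[1+x]^[1+n] x zero = ≤-reflexive (x*1+1≡[1+x]*1 x)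
  where
  x*1+1≡[1+x]*1 : ∀ x → x * 1 + 1 * 1 ≡ suc x * 1
  x*1+1≡[1+x]*1 = solve-∀
x^[1+n]+[1+n]*x^n≤[1+x]^[1+n] x (suc n) = begin
    x ^ (2 + n) + (2 + n) * x ^ (1 + n)
  ≤⟨ m≤m+n _ ((1 + n) * x ^ n) ⟩
    x ^ (2 + n) + (2 + n) * x ^ (1 + n) + (1 + n) * x ^ n
  ≡⟨ expand x n (x ^ n) ⟩
    suc x * (x ^ (1 + n) + (1 + n) * x ^ n)
  ≤⟨ *-monoʳ-≤ (suc x) (x^[1+n]+[1+n]*x^n≤[1+x]^[1+n] x n) ⟩
    suc x ^ (2 + n) ∎
  where
  open ≤-Reasoning
  expand : ∀ x n xⁿ → x * (x * xⁿ) + (2 + n) * (x * xⁿ) + (1 + n) * xⁿ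
                    ≡ suc x * (x * xⁿ + (1 + n) * xⁿ)
  expand = solve-∀

^-distribʳ-* : ∀ m n o → (m * n) ^ o ≡ m ^ o * n ^ o
^-distribʳ-* m n zero    = refl
^-distribʳ-* m n (suc o) =
  trans (cong (m * n *_) (^-distribʳ-* m n o)) (interchange m n (m ^ o) (n ^ o))
  where
  interchange : ∀ a b x y → a * b * (x * y) ≡ a * x * (b * y)
  interchange = solve-∀

[2*a]^[2*n]≡4^n*a^[2*n] : ∀ a n → (2 * a) ^ (2 * n) ≡ 4 ^ n * a ^ (2 * n)
[2*a]^[2*n]≡4^n*a^[2*n] a n =
  trans (^-distribʳ-* 2 a (2 * n)) (cong (_* a ^ (2 * n)) (sym (^-*-assoc 2 2 n)))

^-cancelˡ-≤ : ∀ m {n o} → 1 < m → m ^ n ≤ m ^ o → n ≤ o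
^-cancelˡ-≤ m {n} {o} 1<m mⁿ≤mᵒ with n ≤? o
... | yes n≤o = n≤o
... | no  n≰o = contradiction mⁿ≤mᵒ (<⇒≱ (^-monoʳ-< m 1<m (≰⇒> n≰o)))

2*[3+n]≡2+2*[2+n] : ∀ n → 2 * (3 + n) ≡ 2 + 2 * (2 + n)
2*[3+n]≡2+2*[2+n] n = *-distribˡ-+ 2 1 (2 + n)

-- weight n = W_L and shift n = t_L for L = 2 + n.
weight : ℕ → ℕ
weight zero    = 8
weight (suc n) = 2 * (3 + n) * 4 ^ (1 + n) * weight n

shift : ℕ → ℕ
shift zero    = 10
shift (suc n) = 2 + 2 * shift n

LevelBound : ℕ → ℕ → Set
LevelBound n k = weight n * c k ≤ (k + shift n) ^ (2 * (2 + n))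

weight-nonZero : ∀ n → NonZero (weight n)
weight-nonZero zero    = _
weight-nonZero (suc n) =
  m*n≢0 (2 * (3 + n) * 4 ^ (1 + n)) (weight n)
    {{m*n≢0 (2 * (3 + n)) (4 ^ (1 + n)) {{_}} {{m^n≢0 4 (1 + n)}}}} {{weight-nonZero n}}

n<shift : ∀ n → n < shift n
n<shift zero    = s≤s z≤n
n<shift (suc n) = s≤s (s≤s (≤-trans (<⇒≤ (n<shift n)) (m≤m+n (shift n) (shift n + 0))))

shift+2≡3*2^[2+n] : ∀ n → shift n + 2 ≡ 3 * 2 ^ (2 + n)
shift+2≡3*2^[2+n] zero    = refl
shift+2≡3*2^[2+n] (suc n) = begin
    2 + 2 * shift n + 2   ≡⟨ regroup (shift n) ⟩
    2 * (shift n + 2)     ≡⟨ cong (2 *_) (shift+2≡3*2^[2+n] n) ⟩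
    2 * (3 * 2 ^ (2 + n)) ≡⟨ swap (2 ^ (2 + n)) ⟩
    3 * 2 ^ (3 + n)       ∎
  where
  open ≡-Reasoning
  regroup : ∀ s → 2 + 2 * s + 2 ≡ 2 * (s + 2)
  regroup = solve-∀
  swap : ∀ x → 2 * (3 * x) ≡ 3 * (2 * x)
  swap = solve-∀

weight*530≤[2+shift]^[2*[2+n]] : ∀ n → weight n * 530 ≤ (2 + shift n) ^ (2 * (2 + n))
weight*530≤[2+shift]^[2*[2+n]] zero    = ≤ᵇ⇒≤ (8 * 530) (12 ^ 4) _
weight*530≤[2+shift]^[2*[2+n]] (suc n) = begin
    e′ * F * weight n * 530
  ≡⟨ *-assoc (e′ * F) (weight n) 530 ⟩
    e′ * F * (weight n * 530)
  ≤⟨ *-monoʳ-≤ (e′ * F) (weight*530≤[2+shift]^[2*[2+n]] n) ⟩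
    e′ * F * y ^ e
  ≤⟨ *-monoˡ-≤ (y ^ e) (*-monoˡ-≤ F e′≤4*[2y]²) ⟩
    4 * (2 * y * (2 * y)) * F * y ^ e
  ≡⟨ regroup (2 * y) F (y ^ e) ⟩
    2 * y * (2 * y * (4 * F * y ^ e))
  ≡⟨ cong (λ z → 2 * y * (2 * y * z)) (sym ([2*a]^[2*n]≡4^n*a^[2*n] y (2 + n))) ⟩
    (2 * y) ^ (2 + e)
  ≡⟨ cong₂ _^_ (2*[2+s]≡2+[2+2*s] (shift n)) (sym (2*[3+n]≡2+2*[2+n] n)) ⟩
    (2 + shift (suc n)) ^ e′ ∎
  where
  open ≤-Reasoning
  F = 4 ^ (1 + n)
  y = 2 + shift n
  e = 2 * (2 + n)
  e′ = 2 * (3 + n)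
  e′≤4*[2y]² : e′ ≤ 4 * (2 * y * (2 * y))
  e′≤4*[2y]² = begin
      2 * (3 + n)
    ≤⟨ *-monoʳ-≤ 2 (s≤s (s≤s (n<shift n))) ⟩
      2 * y
    ≤⟨ m≤m*n (2 * y) (2 * y) {{>-nonZero (s≤s z≤n)}} ⟩
      2 * y * (2 * y)
    ≤⟨ m≤n*m _ 4 ⟩
      4 * (2 * y * (2 * y)) ∎
  regroup : ∀ a F Y → 4 * (a * a) * F * Y ≡ a * (a * (4 * F * Y))
  regroup = solve-∀
  2*[2+s]≡2+[2+2*s] : ∀ s → 2 * (2 + s) ≡ 2 + (2 + 2 * s)
  2*[2+s]≡2+[2+2*s] = solve-∀

level-bound-small : ∀ n k → 2 ≤ k → c k ≤ 530 → LevelBound n k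
level-bound-small n k 2≤k cₖ≤530 = begin
    weight n * c k
  ≤⟨ *-monoʳ-≤ (weight n) cₖ≤530 ⟩
    weight n * 530
  ≤⟨ weight*530≤[2+shift]^[2*[2+n]] n ⟩
    (2 + shift n) ^ (2 * (2 + n))
  ≤⟨ ^-monoˡ-≤ (2 * (2 + n)) (+-monoˡ-≤ (shift n) 2≤k) ⟩
    (k + shift n) ^ (2 * (2 + n)) ∎
  where open ≤-Reasoning

level-bound-step : ∀ n m → let k = 5 + m in
                   LevelBound (suc n) (4 + m) → LevelBound n ⌈ k /2⌉ → LevelBound (suc n) k
level-bound-step n m prev half = begin
    weight (suc n) * c k
  ≤⟨ *-monoʳ-≤ (weight (suc n)) (c[5+m]≤c[4+m]+4*k*c⌈k/2⌉ m) ⟩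
    weight (suc n) * (c j + 4 * k * c h)
  ≡⟨ regroup e′ F (weight n) (c j) k (c h) ⟩
    weight (suc n) * c j + e′ * k * (4 * F * (weight n * c h))
  ≤⟨ +-mono-≤ prev (*-monoʳ-≤ (e′ * k) (*-monoʳ-≤ (4 * F) half)) ⟩
    x ^ e′ + e′ * k * (4 * F * (h + t) ^ e)
  ≡⟨ cong (λ z → x ^ e′ + e′ * k * z) (sym ([2*a]^[2*n]≡4^n*a^[2*n] (h + t) (2 + n))) ⟩
    x ^ e′ + e′ * k * (2 * (h + t)) ^ e
  ≤⟨ +-monoʳ-≤ (x ^ e′) (*-mono-≤ (*-monoʳ-≤ e′ k≤x) (^-monoˡ-≤ e 2*[h+t]≤x)) ⟩
    x ^ e′ + e′ * x * x ^ e
  ≡⟨ cong (x ^ e′ +_) (*-assoc e′ x (x ^ e)) ⟩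
    x ^ e′ + e′ * x ^ (1 + e)
  ≡⟨ cong (λ z → x ^ z + z * x ^ (1 + e)) (2*[3+n]≡2+2*[2+n] n) ⟩
    x ^ (2 + e) + (2 + e) * x ^ (1 + e)
  ≤⟨ x^[1+n]+[1+n]*x^n≤[1+x]^[1+n] x (1 + e) ⟩
    suc x ^ (2 + e)
  ≡⟨ cong (suc x ^_) (sym (2*[3+n]≡2+2*[2+n] n)) ⟩
    (k + shift (suc n)) ^ e′ ∎
  where
  open ≤-Reasoning
  k = 5 + m
  j = 4 + m
  h = ⌈ k /2⌉
  t = shift n
  F = 4 ^ (1 + n)
  e = 2 * (2 + n)
  e′ = 2 * (3 + n)
  x = j + shift (suc n)
  regroup : ∀ e′ F W cⱼ k cₕ → e′ * F * W * (cⱼ + 4 * k * cₕ)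
                              ≡ e′ * F * W * cⱼ + e′ * k * (4 * F * (W * cₕ))
  regroup = solve-∀
  k≤x : k ≤ x
  k≤x = ≤-trans (m≤m+n k (suc (2 * t))) (≤-reflexive (sym (+-suc j (suc (2 * t)))))
  2*[h+t]≤x : 2 * (h + t) ≤ x
  2*[h+t]≤x = begin
      2 * (h + t)     ≡⟨ *-distribˡ-+ 2 h t ⟩
      2 * h + 2 * t   ≡⟨ cong (_+ 2 * t) (sym (h+h≡2*h h)) ⟩
      h + h + 2 * t   ≤⟨ +-monoˡ-≤ (2 * t) (⌈n/2⌉+⌈n/2⌉≤1+n k) ⟩
      2 + j + 2 * t   ≡⟨ rearrange j t ⟩
      x               ∎
    where
    h+h≡2*h : ∀ h → h + h ≡ 2 * h
    h+h≡2*h = solve-∀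
    rearrange : ∀ j t → 2 + j + 2 * t ≡ j + (2 + 2 * t)
    rearrange = solve-∀

level-bound : ∀ n k → 3 ≤ k → k ≤ 2 ^ (2 + n) → LevelBound n k
level-bound n 0 () _
level-bound n 1 (s≤s ()) _
level-bound n 2 (s≤s (s≤s ())) _
level-bound n 3 _ _ = level-bound-small n 3 (s≤s (s≤s z≤n)) (≤ᵇ⇒≤ (c 3) 530 _)
level-bound n 4 _ _ = level-bound-small n 4 (s≤s (s≤s z≤n)) (≤ᵇ⇒≤ (c 4) 530 _)
level-bound zero (suc (suc (suc (suc (suc m))))) _ (s≤s (s≤s (s≤s (s≤s ()))))
level-bound (suc n) k@(suc (suc (suc (suc (suc m))))) _ k≤2^[3+n] =
  level-bound-step n m (level-bound (suc n) (suc (suc (suc (suc m)))) 3≤4+m 4+m≤2^[3+n])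
                       (level-bound n ⌈ k /2⌉ 3≤⌈k/2⌉ ⌈k/2⌉≤2^[2+n])
  where
  3≤4+m : 3 ≤ 4 + m
  3≤4+m = ≤-trans (n≤1+n 3) (m≤m+n 4 m)
  4+m≤2^[3+n] : 4 + m ≤ 2 ^ (3 + n)
  4+m≤2^[3+n] = ≤-trans (n≤1+n (4 + m)) k≤2^[3+n]
  3≤⌈k/2⌉ : 3 ≤ ⌈ k /2⌉
  3≤⌈k/2⌉ = ⌈n/2⌉-mono {5} {k} (m≤m+n 5 m)
  X = 2 ^ (2 + n)
  ⌈k/2⌉≤2^[2+n] : ⌈ k /2⌉ ≤ X
  ⌈k/2⌉≤2^[2+n] = begin
    ⌈ k /2⌉           ≤⟨ ⌈n/2⌉-mono k≤2^[3+n] ⟩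
    ⌈ X + (X + 0) /2⌉ ≡⟨ cong ⌈_/2⌉ (cong (X +_) (+-identityʳ X)) ⟩
    ⌈ X + X /2⌉       ≡⟨ n≡⌈n+n/2⌉ X ⟨
    X                 ∎
    where open ≤-Reasoning

k+shift≤2^[4+n] : ∀ n {k} → k ≤ 2 ^ (2 + n) → k + shift n ≤ 2 ^ (4 + n)
k+shift≤2^[4+n] n {k} k≤2^[2+n] = begin
    k + shift n             ≤⟨ +-mono-≤ k≤2^[2+n] (m≤m+n (shift n) 2) ⟩
    X + (shift n + 2)       ≡⟨ cong (X +_) (shift+2≡3*2^[2+n] n) ⟩
    X + 3 * X               ≡⟨ x+3*x≡2*[2*x] X ⟩
    2 ^ (4 + n)             ∎
  where
  open ≤-Reasoning
  X = 2 ^ (2 + n)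
  x+3*x≡2*[2*x] : ∀ x → x + 3 * x ≡ 2 * (2 * x)
  x+3*x≡2*[2*x] = solve-∀

-- The weight gains the factor 2 * (3 + n) * 4 ^ (1 + n) per level, while 2 ^ ((5 + n) * (5 + n))
-- gains 2 * 4 ^ (5 + n) = 2 * 4 ^ 4 * 4 ^ (1 + n); hence the threshold 4 ^ 4 = 256 ≤ 3 + n.
weight-lower-bound : ∀ n₀ → 256 ≤ 3 + n₀ → ∀ {n} → n₀ ≤′ n →
                     2 ^ ((5 + n) * (5 + n)) ≤ 2 ^ ((5 + n₀) * (5 + n₀)) * weight n
weight-lower-bound n₀ _ ≤′-refl = m≤m*n _ (weight n₀) {{weight-nonZero n₀}}
weight-lower-bound n₀ 256≤3+n₀ (≤′-step {n} n₀≤′n) = begin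
    2 ^ ((6 + n) * (6 + n))
  ≡⟨ cong (2 ^_) (square-suc (5 + n)) ⟩
    2 ^ ((5 + n) * (5 + n) + suc (2 * (5 + n)))
  ≡⟨ ^-distribˡ-+-* 2 ((5 + n) * (5 + n)) (suc (2 * (5 + n))) ⟩
    2 ^ ((5 + n) * (5 + n)) * (2 * 2 ^ (2 * (5 + n)))
  ≤⟨ *-monoˡ-≤ _ (weight-lower-bound n₀ 256≤3+n₀ n₀≤′n) ⟩
    C * weight n * (2 * 2 ^ (2 * (5 + n)))
  ≡⟨ cong (λ z → C * weight n * (2 * z)) (sym (^-*-assoc 2 2 (5 + n))) ⟩
    C * weight n * (2 * 4 ^ (5 + n))
  ≡⟨ cong (λ z → C * weight n * (2 * z)) (^-distribˡ-+-* 4 4 (1 + n)) ⟩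
    C * weight n * (2 * (256 * F))
  ≤⟨ *-monoʳ-≤ (C * weight n) (*-monoʳ-≤ 2 (*-monoˡ-≤ F 256≤3+n)) ⟩
    C * weight n * (2 * ((3 + n) * F))
  ≡⟨ regroup C (weight n) (3 + n) F ⟩
    C * weight (suc n) ∎
  where
  open ≤-Reasoning
  C = 2 ^ ((5 + n₀) * (5 + n₀))
  F = 4 ^ (1 + n)
  256≤3+n : 256 ≤ 3 + n
  256≤3+n = ≤-trans 256≤3+n₀ (+-monoʳ-≤ 3 (≤′⇒≤ n₀≤′n))
  square-suc : ∀ a → suc a * suc a ≡ a * a + suc (2 * a)
  square-suc = solve-∀
  regroup : ∀ C W a F → C * W * (2 * (a * F)) ≡ C * (2 * a * F * W)
  regroup = solve-∀

c≤C*2^[[1+n]*[1+n]] : ∀ n₀ → 256 ≤ 3 + n₀ → ∀ n → n₀ ≤ n → ∀ k → 3 ≤ k → k ≤ 2 ^ (2 + n) →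
                      c k ≤ 2 ^ ((5 + n₀) * (5 + n₀)) * 2 ^ ((1 + n) * (1 + n))
c≤C*2^[[1+n]*[1+n]] n₀ 256≤3+n₀ n n₀≤n k 3≤k k≤2^[2+n] =
  *-cancelˡ-≤ (weight n) {{weight-nonZero n}} (begin
    weight n * c k
  ≤⟨ level-bound n k 3≤k k≤2^[2+n] ⟩
    (k + shift n) ^ e
  ≤⟨ ^-monoˡ-≤ e (k+shift≤2^[4+n] n k≤2^[2+n]) ⟩
    (2 ^ (4 + n)) ^ e
  ≡⟨ ^-*-assoc 2 (4 + n) e ⟩
    2 ^ ((4 + n) * e)
  ≤⟨ ^-monoʳ-≤ 2 (≤-trans (m≤m+n ((4 + n) * e) 10) (≤-reflexive (exponent-gap n))) ⟩
    2 ^ ((5 + n) * (5 + n) + (1 + n) * (1 + n))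
  ≡⟨ ^-distribˡ-+-* 2 ((5 + n) * (5 + n)) ((1 + n) * (1 + n)) ⟩
    2 ^ ((5 + n) * (5 + n)) * X
  ≤⟨ *-monoˡ-≤ X (weight-lower-bound n₀ 256≤3+n₀ (≤⇒≤′ n₀≤n)) ⟩
    C * weight n * X
  ≡⟨ regroup C (weight n) X ⟩
    weight n * (C * X) ∎)
  where
  open ≤-Reasoning
  C = 2 ^ ((5 + n₀) * (5 + n₀))
  X = 2 ^ ((1 + n) * (1 + n))
  e = 2 * (2 + n)
  exponent-gap : ∀ n → (4 + n) * (2 * (2 + n)) + 10 ≡ (5 + n) * (5 + n) + (1 + n) * (1 + n)
  exponent-gap = solve-∀
  regroup : ∀ C W X → C * W * X ≡ W * (C * X)
  regroup = solve-∀

LeCPowLog-intro : ∀ {a C k} M → 2 ^ M ≤ k → a ≤ C * k ^ M → LeCPowLog a C k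
LeCPowLog-intro {a} {C} {k} M 2^M≤k a≤C*k^M p q _ k^q≤2^p = begin
    a ^ q               ≤⟨ ^-monoˡ-≤ q a≤C*k^M ⟩
    (C * k ^ M) ^ q     ≡⟨ ^-distribʳ-* C (k ^ M) q ⟩
    C ^ q * (k ^ M) ^ q ≡⟨ cong (C ^ q *_) (^-*-assoc k M q) ⟩
    C ^ q * k ^ (M * q) ≤⟨ *-monoʳ-≤ (C ^ q) (^-monoʳ-≤ k {{k≢0}} M*q≤p) ⟩
    C ^ q * k ^ p       ∎
  where
  open ≤-Reasoning
  k≢0 : NonZero k
  k≢0 = >-nonZero (≤-trans (m^n>0 2 M) 2^M≤k)
  M*q≤p : M * q ≤ p
  M*q≤p = ^-cancelˡ-≤ 2 {M * q} {p} (s≤s (s≤s z≤n)) (begin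
    2 ^ (M * q)  ≡⟨ sym (^-*-assoc 2 M q) ⟩
    (2 ^ M) ^ q  ≤⟨ ^-monoˡ-≤ q 2^M≤k ⟩
    k ^ q        ≤⟨ k^q≤2^p ⟩
    2 ^ p        ∎)

dyadic-bracket : ∀ k → 1 ≤ k → ∃ λ M → 2 ^ M ≤ k × k ≤ 2 ^ suc M
dyadic-bracket 1 _ = 0 , ≤-refl , s≤s z≤n
dyadic-bracket (suc (suc k)) _ with dyadic-bracket (suc k) (s≤s z≤n)
... | M , 2^M≤1+k , 1+k≤2^[1+M] with 2 + k ≤? 2 ^ suc M
...   | yes 2+k≤2^[1+M] = M , m≤n⇒m≤1+n 2^M≤1+k , 2+k≤2^[1+M]
...   | no  2+k≰2^[1+M] = suc M , <⇒≤ (≰⇒> 2+k≰2^[1+M]) , (begin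
          2 + k            ≤⟨ s≤s 1+k≤2^[1+M] ⟩
          1 + X            ≤⟨ +-monoˡ-≤ X (m^n>0 2 (suc M)) ⟩
          X + X            ≡⟨ cong (X +_) (sym (+-identityʳ X)) ⟩
          2 ^ (2 + M)      ∎)
  where
  open ≤-Reasoning
  X = 2 ^ suc M

c-LeCPowLog : ∀ n₀ → 256 ≤ 3 + n₀ → ∀ k → 2 ^ (2 + n₀) ≤ k →
              LeCPowLog (c k) (2 ^ ((5 + n₀) * (5 + n₀))) k
c-LeCPowLog n₀ 256≤3+n₀ k 2^[2+n₀]≤k
  with dyadic-bracket k (≤-trans (m^n>0 2 (2 + n₀)) 2^[2+n₀]≤k)
... | M , 2^M≤k , k≤2^[1+M]
  with ^-cancelˡ-≤ 2 {2 + n₀} {suc M} (s≤s (s≤s z≤n)) (≤-trans 2^[2+n₀]≤k k≤2^[1+M])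
... | s≤s (s≤s {n = n} n₀≤n) = LeCPowLog-intro (suc n) 2^M≤k (begin
    c k                  ≤⟨ c≤C*2^[[1+n]*[1+n]] n₀ 256≤3+n₀ n n₀≤n k 3≤k k≤2^[1+M] ⟩
    C * 2 ^ (M * M)      ≡⟨ cong (C *_) (sym (^-*-assoc 2 M M)) ⟩
    C * (2 ^ M) ^ M      ≤⟨ *-monoʳ-≤ C (^-monoˡ-≤ M 2^M≤k) ⟩
    C * k ^ M            ∎)
  where
  open ≤-Reasoning
  C = 2 ^ ((5 + n₀) * (5 + n₀))
  3≤k : 3 ≤ k
  3≤k = ≤-trans (n≤1+n 3) (≤-trans (^-monoʳ-≤ 2 (m≤m+n 2 n₀)) 2^[2+n₀]≤k)

lemmaA2 : ∃₂ λ (C N : ℕ) → (k : ℕ) → 2 ≤ k → N ≤ k → LeCPowLog (c k) C k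
lemmaA2 = 2 ^ ((5 + n₀) * (5 + n₀)) , 2 ^ (2 + n₀) , λ k _ → c-LeCPowLog n₀ ≤-refl k
  where
  n₀ = 253
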